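{- Let $w,v,w',v'\in\Sigma^\ast$ with $\mathrm{alph}(w)=\mathrm{alph}(v)$, $\mathrm{alph}(w')=\mathrm{alph}(v')$ and $\mathrm{alph}(w)\cap\mathrm{alph}(w')=\emptyset$. If $|w|_a=|v|_a$ for all $a\in\mathrm{alph}(w)$ and $|w'|_b=|v'|_b$ for all $b\in\mathrm{alph}(w')$, then the join $G(w,v)\nabla G(w',v')$ equals $G(ww',vv')$.
   Context: $\Sigma$ is a finite alphabet; $\mathrm{alph}(w)$ is the set of letters occurring in $w$ and $|w|_a$ the number of occurrences of $a$ in $w$. For letters $a,b$, $\pi_{a,b}$ is the monoid morphism on $\Sigma^\ast$ with $a\mapsto a$, $b\mapsto b$ and all other letters mapped to the empty word. For words $w,v$ with $\mathrm{alph}(w)=\mathrm{alph}(v)=A$, $G(w,v)$ is the undirected simple graph on vertex set $A$ in which distinct $a,b$ are adjacent iff $\pi_{a,b}(w)=\pi_{a,b}(v)$. For graphs $G=(V,E)$, $G'=(V',E')$ with disjoint vertex sets, the join $G\nabla G'$ has vertex set $V\cup V'$ and edge set $E\cup E'\cup\{\{u,u'\}: u\in V, u'\in V'\}$. -}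

module Defs where

open import Level using (Level; _⊔_; suc)
open import Data.List using (List; []; _∷_; _++_; filter; length)
open import Data.List.Membership.Propositional using (_∈_)
open import Data.Product using (_×_; Σ)
open import Data.Sum using (_⊎_)
open import Data.Empty using (⊥)
open import Relation.Nullary using (¬_; Dec)
open import Relation.Nullary.Decidable using (_⊎-dec_)
open import Relation.Binary.Definitions using (DecidableEquality)
open import Relation.Binary.PropositionalEquality using (_≡_)
open import Data.Nat using (ℕ)
open import Function.Bundles using (_⇔_)

module Words {A : Set} (_≟_ : DecidableEquality A) where

  -- x ∈ alph(w)  is  x ∈ w ; alph(w) = alph(v) means same letters occur
  SameAlph : List A → List A → Set
  SameAlph w v = ∀ x → (x ∈ w) ⇔ (x ∈ v)

  count : A → List A → ℕ
  count a w = length (filter (λ x → x ≟ a) w)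

  proj : A → A → List A → List A
  proj a b w = filter (λ x → (x ≟ a) ⊎-dec (x ≟ b)) w

  record Graph : Set₁ where
    field
      V : A → Set
      E : A → A → Set

  open Graph public

  G : List A → List A → Graph
  G w v = record
    { V = λ a → a ∈ w
    ; E = λ a b → (a ∈ w) × (b ∈ w) × ¬ (a ≡ b) × (proj a b w ≡ proj a b v)
    }

  -- join G ∇ G' (vertex sets assumed disjoint by the caller)
  _∇_ : Graph → Graph → Graph
  H ∇ H' = record
    { V = λ a → V H a ⊎ V H' a
    ; E = λ a b → E H a b ⊎ E H' a b ⊎ (V H a × V H' b) ⊎ (V H' a × V H b)
    }

  _≅_ : Graph → Graph → Set
  H ≅ H' = (∀ a → V H a ⇔ V H' a) × (∀ a b → E H a b ⇔ E H' a b)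

{-# OPTIONS --safe #-}
-- π_{a,b} distributes over concatenation. For two letters of the same component, the
-- other component contributes nothing to either projection, so adjacency is unchanged.
-- For a in alph(w) and b in alph(w′), the projections of ww′ and vv′ are
-- a^{|w|_a} b^{|w′|_b} and a^{|v|_a} b^{|v′|_b}, which agree by the count hypotheses:
-- these are exactly the edges added by the join.
module Submission where

open import Defs
open import Data.List using (List; []; _∷_; _++_; filter; replicate)
open import Data.List.Membership.Propositional using (_∈_; _∉_)
open import Data.List.Membership.Propositional.Properties using (∈-++⁺ˡ; ∈-++⁺ʳ; ∈-++⁻)
open import Data.List.Relation.Unary.Any using (here; there)
open import Data.List.Relation.Unary.Any.Properties using (++↔)
open import Data.List.Properties using (filter-++; filter-≐; ++-identityʳ)
open import Data.Product using (_×_; _,_)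
open import Data.Sum using (_⊎_; inj₁; inj₂)
open import Data.Sum.Base using (swap)
open import Data.Empty using (⊥-elim)
open import Function using (id)
open import Function.Bundles using (_⇔_; mk⇔; Equivalence)
open import Function.Properties.Inverse using (↔⇒⇔)
open import Relation.Nullary using (¬_; yes; no)
open import Relation.Nullary.Decidable using (_⊎-dec_)
open import Relation.Unary using (Decidable)
open import Relation.Binary.Definitions using (DecidableEquality)
open import Relation.Binary.PropositionalEquality
  using (_≡_; _≢_; ≢-sym; _≗_; refl; sym; trans; cong; cong₂; module ≡-Reasoning)

≡-resp-⇔ : {A : Set} {x x′ y y′ : A} → x ≡ x′ → y ≡ y′ → (x ≡ y) ⇔ (x′ ≡ y′)
≡-resp-⇔ refl refl = mk⇔ id id

module Projection {A : Set} (_≟_ : DecidableEquality A) where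
  open Words _≟_

  ≟-either : ∀ a b → Decidable (λ x → x ≡ a ⊎ x ≡ b)
  ≟-either a b x = (x ≟ a) ⊎-dec (x ≟ b)

  filter-≟-replicate : ∀ a xs → filter (_≟ a) xs ≡ replicate (count a xs) a
  filter-≟-replicate a [] = refl
  filter-≟-replicate a (x ∷ xs) with x ≟ a
  ... | yes refl = cong (x ∷_) (filter-≟-replicate a xs)
  ... | no _ = filter-≟-replicate a xs

  proj-comm : ∀ a b → proj a b ≗ proj b a
  proj-comm a b = filter-≐ (≟-either a b) (≟-either b a) (swap , swap)

  proj-++ : ∀ a b xs ys → proj a b (xs ++ ys) ≡ proj a b xs ++ proj a b ys
  proj-++ a b = filter-++ (≟-either a b)

  proj-∉ : ∀ {a b xs} → a ∉ xs → b ∉ xs → proj a b xs ≡ []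
  proj-∉ {xs = []} _ _ = refl
  proj-∉ {a} {b} {x ∷ xs} a∉ b∉ with x ≟ a | x ≟ b
  ... | yes refl | _ = ⊥-elim (a∉ (here refl))
  ... | no _ | yes refl = ⊥-elim (b∉ (here refl))
  ... | no _ | no _ = proj-∉ (λ p → a∉ (there p)) (λ p → b∉ (there p))

  proj-∉ʳ : ∀ {a b xs} → b ∉ xs → proj a b xs ≡ filter (_≟ a) xs
  proj-∉ʳ {xs = []} _ = refl
  proj-∉ʳ {a} {b} {x ∷ xs} b∉ with x ≟ a | x ≟ b
  ... | yes refl | _ = cong (x ∷_) (proj-∉ʳ (λ p → b∉ (there p)))
  ... | no _ | yes refl = ⊥-elim (b∉ (here refl))
  ... | no _ | no _ = proj-∉ʳ (λ p → b∉ (there p))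

  proj-∉-replicate : ∀ {a b xs} → b ∉ xs → proj a b xs ≡ replicate (count a xs) a
  proj-∉-replicate {a} {xs = xs} b∉ = trans (proj-∉ʳ b∉) (filter-≟-replicate a xs)

  proj-++-∉ʳ : ∀ {a b} xs {ys} → a ∉ ys → b ∉ ys → proj a b (xs ++ ys) ≡ proj a b xs
  proj-++-∉ʳ {a} {b} xs {ys} a∉ b∉ = begin
    proj a b (xs ++ ys)          ≡⟨ proj-++ a b xs ys ⟩
    proj a b xs ++ proj a b ys   ≡⟨ cong (proj a b xs ++_) (proj-∉ a∉ b∉) ⟩
    proj a b xs ++ []            ≡⟨ ++-identityʳ (proj a b xs) ⟩
    proj a b xs                  ∎
    where open ≡-Reasoning

  proj-++-∉ˡ : ∀ {a b xs} ys → a ∉ xs → b ∉ xs → proj a b (xs ++ ys) ≡ proj a b ys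
  proj-++-∉ˡ {a} {b} {xs} ys a∉ b∉ =
    trans (proj-++ a b xs ys) (cong (_++ proj a b ys) (proj-∉ a∉ b∉))

  proj-++-separated : ∀ {a b} xs ys → b ∉ xs → a ∉ ys →
    proj a b (xs ++ ys) ≡ replicate (count a xs) a ++ replicate (count b ys) b
  proj-++-separated {a} {b} xs ys b∉xs a∉ys = begin
    proj a b (xs ++ ys)                                   ≡⟨ proj-++ a b xs ys ⟩
    proj a b xs ++ proj a b ys                            ≡⟨ cong (proj a b xs ++_) (proj-comm a b ys) ⟩
    proj a b xs ++ proj b a ys                            ≡⟨ cong₂ _++_ (proj-∉-replicate b∉xs) (proj-∉-replicate a∉ys) ⟩
    replicate (count a xs) a ++ replicate (count b ys) b  ∎
    where open ≡-Reasoning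

module Join {A : Set} (_≟_ : DecidableEquality A) (w v w′ v′ : List A)
            (w≈v : Words.SameAlph _≟_ w v) (w′≈v′ : Words.SameAlph _≟_ w′ v′)
            (disjoint : ∀ a → ¬ (a ∈ w × a ∈ w′))
            (count-w : ∀ a → a ∈ w → Words.count _≟_ a w ≡ Words.count _≟_ a v)
            (count-w′ : ∀ b → b ∈ w′ → Words.count _≟_ b w′ ≡ Words.count _≟_ b v′) where
  open Words _≟_
  open Projection _≟_

  ∈w⇒∉w′ : ∀ {a} → a ∈ w → a ∉ w′
  ∈w⇒∉w′ a∈w a∈w′ = disjoint _ (a∈w , a∈w′)

  ∈w′⇒∉w : ∀ {a} → a ∈ w′ → a ∉ w
  ∈w′⇒∉w a∈w′ a∈w = disjoint _ (a∈w , a∈w′)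

  ∈w⇒∉v′ : ∀ {a} → a ∈ w → a ∉ v′
  ∈w⇒∉v′ a∈w a∈v′ = ∈w⇒∉w′ a∈w (Equivalence.from (w′≈v′ _) a∈v′)

  ∈w′⇒∉v : ∀ {a} → a ∈ w′ → a ∉ v
  ∈w′⇒∉v a∈w′ a∈v = ∈w′⇒∉w a∈w′ (Equivalence.from (w≈v _) a∈v)

  ∈w∈w′⇒≢ : ∀ {a b} → a ∈ w → b ∈ w′ → a ≢ b
  ∈w∈w′⇒≢ a∈w b∈w′ refl = disjoint _ (a∈w , b∈w′)

  edge-within-w : ∀ {a b} → a ∈ w → b ∈ w →
    (proj a b w ≡ proj a b v) ⇔ (proj a b (w ++ w′) ≡ proj a b (v ++ v′))
  edge-within-w a∈w b∈w = ≡-resp-⇔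
    (sym (proj-++-∉ʳ w (∈w⇒∉w′ a∈w) (∈w⇒∉w′ b∈w)))
    (sym (proj-++-∉ʳ v (∈w⇒∉v′ a∈w) (∈w⇒∉v′ b∈w)))

  edge-within-w′ : ∀ {a b} → a ∈ w′ → b ∈ w′ →
    (proj a b w′ ≡ proj a b v′) ⇔ (proj a b (w ++ w′) ≡ proj a b (v ++ v′))
  edge-within-w′ a∈w′ b∈w′ = ≡-resp-⇔
    (sym (proj-++-∉ˡ w′ (∈w′⇒∉w a∈w′) (∈w′⇒∉w b∈w′)))
    (sym (proj-++-∉ˡ v′ (∈w′⇒∉v a∈w′) (∈w′⇒∉v b∈w′)))

  edge-across : ∀ {a b} → a ∈ w → b ∈ w′ → proj a b (w ++ w′) ≡ proj a b (v ++ v′)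
  edge-across {a} {b} a∈w b∈w′ = begin
    proj a b (w ++ w′)                                   ≡⟨ proj-++-separated w w′ (∈w′⇒∉w b∈w′) (∈w⇒∉w′ a∈w) ⟩
    replicate (count a w) a ++ replicate (count b w′) b  ≡⟨ cong₂ (λ m n → replicate m a ++ replicate n b)
                                                                  (count-w a a∈w) (count-w′ b b∈w′) ⟩
    replicate (count a v) a ++ replicate (count b v′) b  ≡⟨ proj-++-separated v v′ (∈w′⇒∉v b∈w′) (∈w⇒∉v′ a∈w) ⟨
    proj a b (v ++ v′)                                   ∎
    where open ≡-Reasoning

  edge-across′ : ∀ {a b} → a ∈ w′ → b ∈ w → proj a b (w ++ w′) ≡ proj a b (v ++ v′)
  edge-across′ {a} {b} a∈w′ b∈w =
    trans (proj-comm a b (w ++ w′)) (trans (edge-across b∈w a∈w′) (proj-comm b a (v ++ v′)))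

  vertices : ∀ a → V (G w v ∇ G w′ v′) a ⇔ V (G (w ++ w′) (v ++ v′)) a
  vertices a = ↔⇒⇔ ++↔

  edges : ∀ a b → E (G w v ∇ G w′ v′) a b ⇔ E (G (w ++ w′) (v ++ v′)) a b
  edges a b = mk⇔ join⇒concat concat⇒join
    where
      join⇒concat : E (G w v ∇ G w′ v′) a b → E (G (w ++ w′) (v ++ v′)) a b
      join⇒concat (inj₁ (a∈w , b∈w , a≢b , eq)) =
        ∈-++⁺ˡ a∈w , ∈-++⁺ˡ b∈w , a≢b , Equivalence.to (edge-within-w a∈w b∈w) eq
      join⇒concat (inj₂ (inj₁ (a∈w′ , b∈w′ , a≢b , eq))) =
        ∈-++⁺ʳ w a∈w′ , ∈-++⁺ʳ w b∈w′ , a≢b , Equivalence.to (edge-within-w′ a∈w′ b∈w′) eq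
      join⇒concat (inj₂ (inj₂ (inj₁ (a∈w , b∈w′)))) =
        ∈-++⁺ˡ a∈w , ∈-++⁺ʳ w b∈w′ , ∈w∈w′⇒≢ a∈w b∈w′ , edge-across a∈w b∈w′
      join⇒concat (inj₂ (inj₂ (inj₂ (a∈w′ , b∈w)))) =
        ∈-++⁺ʳ w a∈w′ , ∈-++⁺ˡ b∈w , ≢-sym (∈w∈w′⇒≢ b∈w a∈w′) , edge-across′ a∈w′ b∈w

      concat⇒join : E (G (w ++ w′) (v ++ v′)) a b → E (G w v ∇ G w′ v′) a b
      concat⇒join (a∈ , b∈ , a≢b , eq) with ∈-++⁻ w a∈ | ∈-++⁻ w b∈
      ... | inj₁ a∈w  | inj₁ b∈w  = inj₁ (a∈w , b∈w , a≢b , Equivalence.from (edge-within-w a∈w b∈w) eq)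
      ... | inj₂ a∈w′ | inj₂ b∈w′ = inj₂ (inj₁ (a∈w′ , b∈w′ , a≢b , Equivalence.from (edge-within-w′ a∈w′ b∈w′) eq))
      ... | inj₁ a∈w  | inj₂ b∈w′ = inj₂ (inj₂ (inj₁ (a∈w , b∈w′)))
      ... | inj₂ a∈w′ | inj₁ b∈w  = inj₂ (inj₂ (inj₂ (a∈w′ , b∈w)))

theorem10 : {Σ : Set} (_≟_ : DecidableEquality Σ) (w v w′ v′ : List Σ) →
    Words.SameAlph _≟_ w v →
    Words.SameAlph _≟_ w′ v′ →
    (∀ a → ¬ (a ∈ w × a ∈ w′)) →
    (∀ a → a ∈ w → Words.count _≟_ a w ≡ Words.count _≟_ a v) →
    (∀ b → b ∈ w′ → Words.count _≟_ b w′ ≡ Words.count _≟_ b v′) →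
    Words._≅_ _≟_ (Words._∇_ _≟_ (Words.G _≟_ w v) (Words.G _≟_ w′ v′)) (Words.G _≟_ (w ++ w′) (v ++ v′))
theorem10 _≟_ w v w′ v′ w≈v w′≈v′ disjoint count-w count-w′ = vertices , edges
  where open Join _≟_ w v w′ v′ w≈v w′≈v′ disjoint count-w count-w′
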